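{- In the setting below, the function $f_{\rm plt}\colon 2^R\to\mathbb{R}_+$ defined by \[ f_{\rm plt}(X)=\bigl|(V\setminus {\rm supp}(\phi))\cap N[X]\bigr| + \sum_{v \in (V\setminus {\rm supp}(\phi)) \setminus N[X]}\Bigl(1- \sum_{\psi \in \Psi_{X \cap H}:\, v \sim_{\psi} r}p(\psi)\Bigr) \] for $X\subseteq R$ is monotone (i.e., $f_{\rm plt}(X)\le f_{\rm plt}(Y)$ whenever $X\subseteq Y\subseteq R$) and submodular.
   Context: Let $G=(V,E)$ be an undirected graph with a root node $r\in V$. For $v\in V$, $N[v]$ denotes $v$ together with its neighbors, and for $X\subseteq V$, $N[X]=\bigcup_{v\in X}N[v]$; $G[X]$ is the subgraph induced by $X$. A full realization is a vector $\psi\in\{0,1\}^V$ with $\psi(r)=1$ ($\psi(v)=1$ means $v$ is active); $\Psi$ is the set of full realizations, and $p$ is a probability distribution on $\Psi$. Let $A_\psi=\{v:\psi(v)=1\}$. For $\psi\in\Psi$ and $u,v\in V$, write $u\sim_\psi v$ if $u,v$ are both active and lie in the same connected component of $G[A_\psi]$. A realization is a vector $\phi\in\{0,1,*\}^V$, with ${\rm supp}(\phi)=\{v:\phi(v)\ne *\}$; a vector $\psi$ extends $\phi$, written $\psi\succeq\phi$, if $\psi(v)=\phi(v)$ for all $v\in{\rm supp}(\phi)$. For $\psi\succeq\phi$, $p(\psi\mid\phi)=p(\psi)/\sum_{\psi'\in\Psi:\psi'\succeq\phi}p(\psi')$. Fix a realization $\phi$ with $\phi(r)=1$ and $\sum_{\psi\succeq\phi}p(\psi)>0$,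 and a set $U\subseteq{\rm supp}(\phi)$ with $r\in U$. Let $\Psi_\phi=\{\psi\in\Psi:\psi\succeq\phi,\ p(\psi)>0\}$, let $H=\{v\in V\setminus U:\sum_{\psi\in\Psi_\phi:\,v\in A_\psi}p(\psi\mid\phi)>1/2\}$, and let $R$ be the node set of the connected component of $G[U\cup H]$ containing $r$. For $v\in R\cap H$ define $\xi_v\in\{0,1,*\}^V$ by $\xi_v(u)=*$ for $u\notin N[v]$, $\xi_v(u)=1$ for $u\in H\cap N[v]$, and $\xi_v(u)=0$ for $u\in N[v]\setminus H$. For $H'\subseteq R\cap H$, let $\Psi_{H'}=\{\psi\in\Psi_\phi:\psi\succeq\xi_v \text{ for all } v\in H'\}$.
   Formalization: The probability distribution p on Ψ takes rational values, so $f_{\rm plt}$ is rational-valued as well. -}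

module Defs where

open import Data.Nat using (ℕ; zero; suc)
open import Data.Fin using (Fin; _≟_)
open import Data.Bool using (Bool; true; false; not; _∧_; _∨_; if_then_else_; T)
open import Data.Maybe using (Maybe; just; nothing)
open import Data.Vec using (Vec; []; _∷_; lookup; tabulate)
open import Data.List using (List; []; _∷_; map; _++_; filterᵇ; allFin; length; foldr)
open import Data.Bool.ListAction using (all; any)
open import Data.Rational using (ℚ; 0ℚ; 1ℚ; ½; _+_; _-_; _÷_; _≤_; _<_; >-nonZero)
open import Data.Rational.Properties using (_<?_)
open import Relation.Nullary using (Dec; yes; no; ¬_)
open import Relation.Nullary.Decidable using (⌊_⌋)
open import Relation.Binary.PropositionalEquality using (_≡_; _≢_)
open import Data.Fin.Subset using (Subset; _∈_)

Σℚ : List ℚ → ℚ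
Σℚ = foldr _+_ 0ℚ

card : ∀ {A : Set} → List A → ℚ
card xs = Σℚ (map (λ _ → 1ℚ) xs)

-- all 0/1 vectors indexed by V = Fin n (true = 1 = active)
allVecs : (n : ℕ) → List (Vec Bool n)
allVecs zero = [] ∷ []
allVecs (suc n) = map (true ∷_) (allVecs n) ++ map (false ∷_) (allVecs n)

_==_ : Bool → Bool → Bool
true == b = b
false == b = not b

-- Realizations {0,1,*}^V : nothing = *, just true = 1, just false = 0.
Realization : ℕ → Set
Realization n = Vec (Maybe Bool) n

extends : ∀ {n} → Vec Bool n → Realization n → Bool
extends {n} ψ φ = all (λ i → ext (lookup φ i) (lookup ψ i)) (allFin n)
  where
  ext : Maybe Bool → Bool → Bool
  ext nothing _ = true
  ext (just b) c = b == c

-- Reach W u v : there is a walk from u to v in G[W] (W given as a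
-- membership function); in particular u and v both belong to W.
data Reach {n : ℕ} (adj : Fin n → Fin n → Bool) (W : Fin n → Bool) (u : Fin n) : Fin n → Set where
  here : W u ≡ true → Reach adj W u u
  step : ∀ {w v} → Reach adj W u w → adj w v ≡ true → W v ≡ true → Reach adj W u v

-- The standing setting: an undirected graph on V = Fin n with root r,
-- a probability distribution p on Ψ (p is given on all of {0,1}^V and
-- vanishes off Ψ), a realization φ with φ(r)=1 and positive mass, and U.
record Setting (n : ℕ) : Set where
  field
    adj      : Fin n → Fin n → Bool
    adj-sym  : ∀ u v → adj u v ≡ adj v u
    r        : Fin n
    p        : Vec Bool n → ℚ
    p-nonneg : ∀ ψ → 0ℚ ≤ p ψ
    p-offΨ   : ∀ ψ → lookup ψ r ≡ false → p ψ ≡ 0ℚ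
    p-sum    : Σℚ (map p (allVecs n)) ≡ 1ℚ
    φ        : Realization n
    φ-root   : lookup φ r ≡ just true
    φ-mass   : 0ℚ < Σℚ (map p (filterᵇ (λ ψ → extends ψ φ) (allVecs n)))
    U        : Subset n
    U-supp   : ∀ v → v ∈ U → lookup φ v ≢ nothing
    r∈U      : r ∈ U

module _ {n : ℕ} (S : Setting n) where
  open Setting S

  -- Z = Σ_{ψ ∈ Ψ, ψ ⪰ φ} p(ψ)   (ψ ⪰ φ already forces ψ(r) = 1, since φ(r) = 1)
  Z : ℚ
  Z = Σℚ (map p (filterᵇ (λ ψ → extends ψ φ) (allVecs n)))

  condP : Vec Bool n → ℚ
  condP ψ = _÷_ (p ψ) Z {{>-nonZero φ-mass}}

  inΨφ : Vec Bool n → Bool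
  inΨφ ψ = lookup ψ r ∧ extends ψ φ ∧ ⌊ 0ℚ <? p ψ ⌋

  Ψφ : List (Vec Bool n)
  Ψφ = filterᵇ inΨφ (allVecs n)

  inH : Fin n → Bool
  inH v = not (lookup U v) ∧ ⌊ ½ <? Σℚ (map condP (filterᵇ (λ ψ → lookup ψ v) Ψφ)) ⌋

  inN : Fin n → Fin n → Bool
  inN v u = ⌊ u ≟ v ⌋ ∨ adj v u

  inNX : Subset n → Fin n → Bool
  inNX X u = any (λ v → lookup X v ∧ inN v u) (allFin n)

  InR : Fin n → Set
  InR v = Reach adj (λ w → lookup U w ∨ inH w) r v

  ξ : Fin n → Realization n
  ξ v = tabulate (λ u → if inN v u then just (inH u) else nothing)

  inΨXH : Subset n → Vec Bool n → Bool
  inΨXH X ψ = inΨφ ψ ∧ all (λ v → not (lookup X v ∧ inH v) ∨ extends ψ (ξ v)) (allFin n)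

  _∼[_]_ : Fin n → Vec Bool n → Fin n → Set
  u ∼[ ψ ] v = Reach adj (lookup ψ) u v

  -- f_plt, given a decision procedure for v ∼_ψ r (its value does not
  -- depend on which decision procedure is used)
  fplt : (dec : ∀ ψ v → Dec (v ∼[ ψ ] r)) → Subset n → ℚ
  fplt dec X =
      card (filterᵇ (λ v → unsupp v ∧ inNX X v) (allFin n))
    + Σℚ (map (λ v → 1ℚ - Σℚ (map p (filterᵇ (λ ψ → inΨXH X ψ ∧ ⌊ dec ψ v ⌋) (allVecs n))))
              (filterᵇ (λ v → unsupp v ∧ not (inNX X v)) (allFin n)))
    where
    unsupp : Fin n → Bool
    unsupp v with lookup φ v
    ... | nothing = true
    ... | just _  = false

{-# OPTIONS --safe #-}
module Submission where

-- Writing P_X(v) for the p-mass of {ψ ∈ Ψ_{X∩H} : v ∼_ψ r}, one has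
--   f_plt(X) = |V ∖ supp φ| − Σ_{v ∉ supp φ, v ∉ N[X]} P_X(v),
-- so it suffices that the subtracted sum is antitone and supermodular in X.
-- The conditions "v ∉ N[X]" and "ψ ∈ Ψ_{X∩H}" say that every element of X
-- avoids, resp. satisfies, something, so as properties of X they are ideals of
-- the subset lattice (down-closed and closed under binary unions).  Multiplying
-- the indicator of an ideal by a nonnegative antitone supermodular function, and
-- summing such functions, preserves these three properties; applying this first
-- with the constants p(ψ) and then with P_X(v) gives the claim.

open import Defs
open import Algebra.Bundles using (CommutativeMonoid)
open import Data.Bool using (Bool; true; false; not; _∧_; _∨_; T)
open import Data.Bool.ListAction using (all; any)
open import Data.Bool.Properties using (T-≡; T-∧; T-∨)
open import Data.Empty using (⊥-elim)
open import Data.Fin using (Fin)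
open import Data.Fin.Subset using (Subset; _∈_; _⊆_; _∪_; _∩_)
open import Data.Fin.Subset.Properties using (x∈p∪q⁻; p∩q⊆p; p∩q⊆q)
open import Data.List using (List; []; _∷_; map; filterᵇ; allFin)
import Data.List.Relation.Unary.All.Properties as All
import Data.List.Relation.Unary.Any.Properties as Any
open import Data.Nat using (ℕ)
open import Data.Product using (_×_; _,_)
open import Data.Rational using (ℚ; 0ℚ; 1ℚ; _≤_; _+_; _-_; -_)
import Data.Rational.Properties as ℚ
open import Data.Sum using ([_,_]′)
open import Data.Unit using (tt)
open import Data.Vec using (lookup)
open import Data.Vec.Properties using ([]=⇒lookup; lookup⇒[]=)
open import Function using (_∘_; _⇔_; mk⇔; Equivalence)
open import Relation.Nullary using (Dec; ¬_)
open import Relation.Nullary.Decidable using (⌊_⌋)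
open import Relation.Binary.PropositionalEquality
  using (_≡_; refl; sym; trans; cong; cong₂; subst; subst₂; module ≡-Reasoning)
open import Algebra.Properties.CommutativeSemigroup
  (CommutativeMonoid.commutativeSemigroup ℚ.+-0-commutativeMonoid) using (interchange)

open Equivalence using (to; from)

[_]·_ : Bool → ℚ → ℚ
[ true ]· x = x
[ false ]· x = 0ℚ

[]·-nonneg : ∀ b {x} → 0ℚ ≤ x → 0ℚ ≤ [ b ]· x
[]·-nonneg true 0≤x = 0≤x
[]·-nonneg false _ = ℚ.≤-refl

[]·-monoˡ-≤ : ∀ {a b x} → (T a → T b) → 0ℚ ≤ x → [ a ]· x ≤ [ b ]· x
[]·-monoˡ-≤ {false} {b} _ 0≤x = []·-nonneg b 0≤x
[]·-monoˡ-≤ {true} {true} _ _ = ℚ.≤-refl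
[]·-monoˡ-≤ {true} {false} a⇒b _ = ⊥-elim (a⇒b tt)

[]·-monoʳ-≤ : ∀ b {x y} → x ≤ y → [ b ]· x ≤ [ b ]· y
[]·-monoʳ-≤ true x≤y = x≤y
[]·-monoʳ-≤ false _ = ℚ.≤-refl

[]·-supermodular : ∀ a b {x y s t} → x + y ≤ s + t → x ≤ t → y ≤ t →
                   [ a ]· x + [ b ]· y ≤ [ a ∧ b ]· s + [ a ∨ b ]· t
[]·-supermodular true true super _ _ = super
[]·-supermodular true false {x} {t = t} _ x≤t _ =
  subst₂ _≤_ (sym (ℚ.+-identityʳ x)) (sym (ℚ.+-identityˡ t)) x≤t
[]·-supermodular false true _ _ y≤t = ℚ.+-monoʳ-≤ 0ℚ y≤t
[]·-supermodular false false _ _ _ = ℚ.≤-refl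

Σℚ-filterᵇ : ∀ {A : Set} (w : A → ℚ) (q : A → Bool) (xs : List A) →
             Σℚ (map w (filterᵇ q xs)) ≡ Σℚ (map (λ x → [ q x ]· w x) xs)
Σℚ-filterᵇ w q [] = refl
Σℚ-filterᵇ w q (x ∷ xs) with q x
... | true = cong (w x +_) (Σℚ-filterᵇ w q xs)
... | false = trans (Σℚ-filterᵇ w q xs) (sym (ℚ.+-identityˡ _))

+-−-interchange : ∀ a b c d → (a - b) + (c - d) ≡ (a + c) - (b + d)
+-−-interchange a b c d =
  trans (interchange a (- b) c (- d)) (cong (a + c +_) (sym (ℚ.neg-distrib-+ b d)))

Σℚ-+-− : ∀ {A : Set} (f g k l : A → ℚ) (xs : List A) → (∀ x → f x + g x ≡ k x - l x) →
         Σℚ (map f xs) + Σℚ (map g xs) ≡ Σℚ (map k xs) - Σℚ (map l xs)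
Σℚ-+-− f g k l [] _ = refl
Σℚ-+-− f g k l (x ∷ xs) pointwise = begin
  (f x + F) + (g x + G) ≡⟨ interchange (f x) F (g x) G ⟩
  (f x + g x) + (F + G) ≡⟨ cong₂ _+_ (pointwise x) (Σℚ-+-− f g k l xs pointwise) ⟩
  (k x - l x) + (K - L) ≡⟨ +-−-interchange (k x) (l x) K L ⟩
  (k x + K) - (l x + L) ∎
  where
  open ≡-Reasoning
  F G K L : ℚ
  F = Σℚ (map f xs)
  G = Σℚ (map g xs)
  K = Σℚ (map k xs)
  L = Σℚ (map l xs)

[]·-split : ∀ a c y → [ a ∧ c ]· 1ℚ + [ a ∧ not c ]· (1ℚ - y) ≡ [ a ]· 1ℚ - [ a ∧ not c ]· y
[]·-split true true y = refl
[]·-split true false y = ℚ.+-identityˡ (1ℚ - y)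
[]·-split false c y = refl

card-filterᵇ-split : ∀ {A : Set} (u b : A → Bool) (h : A → ℚ) (xs : List A) →
    card (filterᵇ (λ x → u x ∧ b x) xs)
  + Σℚ (map (λ x → 1ℚ - h x) (filterᵇ (λ x → u x ∧ not (b x)) xs))
  ≡ card (filterᵇ u xs) - Σℚ (map (λ x → [ u x ∧ not (b x) ]· h x) xs)
card-filterᵇ-split u b h xs = begin
    card (filterᵇ (λ x → u x ∧ b x) xs)
  + Σℚ (map (λ x → 1ℚ - h x) (filterᵇ (λ x → u x ∧ not (b x)) xs))
    ≡⟨ cong₂ _+_ (Σℚ-filterᵇ (λ _ → 1ℚ) (λ x → u x ∧ b x) xs)
                 (Σℚ-filterᵇ (λ x → 1ℚ - h x) (λ x → u x ∧ not (b x)) xs) ⟩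
    Σℚ (map (λ x → [ u x ∧ b x ]· 1ℚ) xs)
  + Σℚ (map (λ x → [ u x ∧ not (b x) ]· (1ℚ - h x)) xs)
    ≡⟨ Σℚ-+-− _ _ (λ x → [ u x ]· 1ℚ) _ xs (λ x → []·-split (u x) (b x) (h x)) ⟩
  Σℚ (map (λ x → [ u x ]· 1ℚ) xs) - loss
    ≡⟨ cong (_- loss) (sym (Σℚ-filterᵇ (λ _ → 1ℚ) u xs)) ⟩
  card (filterᵇ u xs) - loss ∎
  where
  open ≡-Reasoning
  loss : ℚ
  loss = Σℚ (map (λ x → [ u x ∧ not (b x) ]· h x) xs)

module _ {n : ℕ} where

  Monotone Antitone Submodular Supermodular : (Subset n → ℚ) → Set
  Monotone F = ∀ {X Y} → X ⊆ Y → F X ≤ F Y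
  Antitone F = ∀ {X Y} → X ⊆ Y → F Y ≤ F X
  Submodular F = ∀ X Y → F (X ∪ Y) + F (X ∩ Y) ≤ F X + F Y
  Supermodular F = ∀ X Y → F X + F Y ≤ F (X ∪ Y) + F (X ∩ Y)

  record IsIdeal (b : Subset n → Bool) : Set where
    field
      down     : ∀ {X Y} → X ⊆ Y → T (b Y) → T (b X)
      ∪-closed : ∀ {X Y} → T (b X) → T (b Y) → T (b (X ∪ Y))

  open IsIdeal

  const-isIdeal : ∀ {b} → IsIdeal (λ _ → b)
  const-isIdeal = record { down = λ _ t → t ; ∪-closed = λ t _ → t }

  ∧-isIdeal : ∀ {a b} → IsIdeal a → IsIdeal b → IsIdeal (λ X → a X ∧ b X)
  ∧-isIdeal a-ideal b-ideal = record
    { down = λ X⊆Y t → let ta , tb = to T-∧ t in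
        from T-∧ (down a-ideal X⊆Y ta , down b-ideal X⊆Y tb)
    ; ∪-closed = λ tX tY → let aX , bX = to T-∧ tX ; aY , bY = to T-∧ tY in
        from T-∧ (∪-closed a-ideal aX aY , ∪-closed b-ideal bX bY)
    }

  ∀∈-isIdeal : ∀ (P : Fin n → Set) {b} → (∀ X → T (b X) ⇔ (∀ v → v ∈ X → P v)) → IsIdeal b
  ∀∈-isIdeal P b⇔ = record
    { down = λ X⊆Y bY → from (b⇔ _) (λ v v∈X → to (b⇔ _) bY v (X⊆Y v∈X))
    ; ∪-closed = λ {X} {Y} bX bY → from (b⇔ _) (λ v v∈X∪Y →
        [ to (b⇔ X) bX v , to (b⇔ Y) bY v ]′ (x∈p∪q⁻ X Y v∈X∪Y))
    }

  T-lookup⇔∈ : ∀ {X : Subset n} {v} → T (lookup X v) ⇔ v ∈ X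
  T-lookup⇔∈ {X} {v} =
    mk⇔ (λ t → lookup⇒[]= v X (to T-≡ t)) (λ v∈X → from T-≡ ([]=⇒lookup v∈X))

  T-implication : ∀ {a c e} → T (not (a ∧ c) ∨ e) ⇔ (T a → T c → T e)
  T-implication {true} {true} = mk⇔ (λ t _ _ → t) (λ f → f tt tt)
  T-implication {true} {false} = mk⇔ (λ _ _ ()) (λ _ → tt)
  T-implication {false} = mk⇔ (λ _ ()) (λ _ → tt)

  T-not : ∀ {b} → T (not b) ⇔ (¬ T b)
  T-not {true} = mk⇔ (λ ()) (λ ¬t → ¬t tt)
  T-not {false} = mk⇔ (λ _ ()) (λ _ → tt)

  all-guarded-isIdeal : ∀ (c e : Fin n → Bool) →
                        IsIdeal (λ X → all (λ v → not (lookup X v ∧ c v) ∨ e v) (allFin n))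
  all-guarded-isIdeal c e = ∀∈-isIdeal (λ v → T (c v) → T (e v)) λ X → mk⇔
    (λ t v v∈X →
       to T-implication (All.tabulate⁻ (All.all⁺ _ (allFin n) t) v) (from T-lookup⇔∈ v∈X))
    (λ h → All.all⁻ _ (All.tabulate⁺ λ v → from T-implication (h v ∘ to T-lookup⇔∈)))

  avoiding-isIdeal : ∀ (c : Fin n → Bool) →
                     IsIdeal (λ X → not (any (λ v → lookup X v ∧ c v) (allFin n)))
  avoiding-isIdeal c = ∀∈-isIdeal (λ v → ¬ T (c v)) λ X → mk⇔
    (λ t v v∈X cv →
       to T-not t (Any.any⁺ _ (Any.tabulate⁺ v (from T-∧ (from T-lookup⇔∈ v∈X , cv)))))
    (λ h → from T-not λ t →
       let v , t′ = Any.tabulate⁻ (Any.any⁻ _ (allFin n) t) ; v∈X , cv = to T-∧ t′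
       in h v (to T-lookup⇔∈ v∈X) cv)

  record NonnegAntitoneSupermodular (F : Subset n → ℚ) : Set where
    field
      nonneg       : ∀ X → 0ℚ ≤ F X
      antitone     : Antitone F
      supermodular : Supermodular F

  open NonnegAntitoneSupermodular

  const-nas : ∀ {w} → 0ℚ ≤ w → NonnegAntitoneSupermodular (λ _ → w)
  const-nas 0≤w = record
    { nonneg = λ _ → 0≤w ; antitone = λ _ → ℚ.≤-refl ; supermodular = λ _ _ → ℚ.≤-refl }

  +-nas : ∀ {F G} → NonnegAntitoneSupermodular F → NonnegAntitoneSupermodular G →
          NonnegAntitoneSupermodular (λ X → F X + G X)
  +-nas {F} {G} F-nas G-nas = record
    { nonneg = λ X → ℚ.+-mono-≤ (nonneg F-nas X) (nonneg G-nas X)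
    ; antitone = λ X⊆Y → ℚ.+-mono-≤ (antitone F-nas X⊆Y) (antitone G-nas X⊆Y)
    ; supermodular = λ X Y → subst₂ _≤_
        (interchange (F X) (F Y) (G X) (G Y))
        (interchange (F (X ∪ Y)) (F (X ∩ Y)) (G (X ∪ Y)) (G (X ∩ Y)))
        (ℚ.+-mono-≤ (supermodular F-nas X Y) (supermodular G-nas X Y))
    }

  Σℚ-nas : ∀ {A : Set} {F : A → Subset n → ℚ} (xs : List A) →
           (∀ x → NonnegAntitoneSupermodular (F x)) →
           NonnegAntitoneSupermodular (λ X → Σℚ (map (λ x → F x X) xs))
  Σℚ-nas [] _ = const-nas ℚ.≤-refl
  Σℚ-nas (x ∷ xs) F-nas = +-nas (F-nas x) (Σℚ-nas xs F-nas)

  []·-nas : ∀ {c F} → IsIdeal c → NonnegAntitoneSupermodular F →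
            NonnegAntitoneSupermodular (λ X → [ c X ]· F X)
  []·-nas {c} {F} c-ideal F-nas = record
    { nonneg = λ X → []·-nonneg (c X) (nonneg F-nas X)
    ; antitone = λ {X} {Y} X⊆Y → ℚ.≤-trans
        ([]·-monoʳ-≤ (c Y) (antitone F-nas X⊆Y))
        ([]·-monoˡ-≤ (down c-ideal X⊆Y) (nonneg F-nas X))
    ; supermodular = λ X Y → ℚ.≤-trans
        ([]·-supermodular (c X) (c Y) (supermodular F-nas X Y)
          (antitone F-nas (p∩q⊆p X Y)) (antitone F-nas (p∩q⊆q X Y)))
        (ℚ.+-mono-≤
          ([]·-monoˡ-≤ (λ t → let cX , cY = to T-∧ t in ∪-closed c-ideal cX cY)
                       (nonneg F-nas (X ∪ Y)))
          ([]·-monoˡ-≤ ([ down c-ideal (p∩q⊆p X Y) , down c-ideal (p∩q⊆q X Y) ]′ ∘ to T-∨)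
                       (nonneg F-nas (X ∩ Y))))
    }

  nas-cong : ∀ {F G} → (∀ X → F X ≡ G X) →
             NonnegAntitoneSupermodular F → NonnegAntitoneSupermodular G
  nas-cong F≡G F-nas = record
    { nonneg = λ X → subst (0ℚ ≤_) (F≡G X) (nonneg F-nas X)
    ; antitone = λ {X} {Y} X⊆Y → subst₂ _≤_ (F≡G Y) (F≡G X) (antitone F-nas X⊆Y)
    ; supermodular = λ X Y → subst₂ _≤_
        (cong₂ _+_ (F≡G X) (F≡G Y)) (cong₂ _+_ (F≡G (X ∪ Y)) (F≡G (X ∩ Y)))
        (supermodular F-nas X Y)
    }

  Σℚ-filterᵇ-nas : ∀ {A : Set} {q : Subset n → A → Bool} (w : A → ℚ) (xs : List A) →
                   (∀ x → IsIdeal (λ X → q X x)) → (∀ x → 0ℚ ≤ w x) →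
                   NonnegAntitoneSupermodular (λ X → Σℚ (map w (filterᵇ (q X) xs)))
  Σℚ-filterᵇ-nas {q = q} w xs q-ideal w-nonneg =
    nas-cong (λ X → sym (Σℚ-filterᵇ w (q X) xs))
             (Σℚ-nas xs (λ x → []·-nas (q-ideal x) (const-nas (w-nonneg x))))

  const-−-monotone : ∀ {F} C → Antitone F → Monotone (λ X → C - F X)
  const-−-monotone C F-antitone X⊆Y = ℚ.+-monoʳ-≤ C (ℚ.neg-antimono-≤ (F-antitone X⊆Y))

  const-−-submodular : ∀ {F} C → Supermodular F → Submodular (λ X → C - F X)
  const-−-submodular {F} C F-supermodular X Y = subst₂ _≤_
    (sym (+-−-interchange C (F (X ∪ Y)) C (F (X ∩ Y)))) (sym (+-−-interchange C (F X) C (F Y)))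
    (ℚ.+-monoʳ-≤ (C + C) (ℚ.neg-antimono-≤ (F-supermodular X Y)))

  coverage : ∀ {A : Set} → List A → (A → Bool) → (Subset n → A → Bool) → (Subset n → A → ℚ) →
             Subset n → ℚ
  coverage xs u covered P X =
      card (filterᵇ (λ x → u x ∧ covered X x) xs)
    + Σℚ (map (λ x → 1ℚ - P X x) (filterᵇ (λ x → u x ∧ not (covered X x)) xs))

  module _ {A : Set} (xs : List A) (u : A → Bool)
           {covered : Subset n → A → Bool} {P : Subset n → A → ℚ}
           (uncovered-isIdeal : ∀ x → IsIdeal (λ X → not (covered X x)))
           (P-nas : ∀ x → NonnegAntitoneSupermodular (λ X → P X x)) where

    deficit : Subset n → ℚ
    deficit X = Σℚ (map (λ x → [ u x ∧ not (covered X x) ]· P X x) xs)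

    coverage≡card-deficit : ∀ X → coverage xs u covered P X ≡ card (filterᵇ u xs) - deficit X
    coverage≡card-deficit X = card-filterᵇ-split u (covered X) (P X) xs

    deficit-nas : NonnegAntitoneSupermodular deficit
    deficit-nas = Σℚ-nas xs λ x →
      []·-nas (∧-isIdeal (const-isIdeal {u x}) (uncovered-isIdeal x)) (P-nas x)

    coverage-monotone : Monotone (coverage xs u covered P)
    coverage-monotone {X} {Y} X⊆Y =
      subst₂ _≤_ (sym (coverage≡card-deficit X)) (sym (coverage≡card-deficit Y))
      (const-−-monotone (card (filterᵇ u xs)) (antitone deficit-nas) X⊆Y)

    coverage-submodular : Submodular (coverage xs u covered P)
    coverage-submodular X Y = subst₂ _≤_
      (sym (cong₂ _+_ (coverage≡card-deficit (X ∪ Y)) (coverage≡card-deficit (X ∩ Y))))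
      (sym (cong₂ _+_ (coverage≡card-deficit X) (coverage≡card-deficit Y)))
      (const-−-submodular (card (filterᵇ u xs)) (supermodular deficit-nas) X Y)

module _ {n : ℕ} (S : Setting n) where
  open Setting S

  connection-probability : (∀ ψ v → Dec (_∼[_]_ S v ψ r)) → Subset n → Fin n → ℚ
  connection-probability dec X v =
    Σℚ (map p (filterᵇ (λ ψ → inΨXH S X ψ ∧ ⌊ dec ψ v ⌋) (allVecs n)))

  inΨXH-isIdeal : ∀ ψ → IsIdeal (λ X → inΨXH S X ψ)
  inΨXH-isIdeal ψ =
    ∧-isIdeal const-isIdeal (all-guarded-isIdeal (inH S) (λ v → extends ψ (ξ S v)))

  connection-probability-nas : ∀ dec v →
                               NonnegAntitoneSupermodular (λ X → connection-probability dec X v)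
  connection-probability-nas dec v =
    Σℚ-filterᵇ-nas p (allVecs n) (λ ψ → ∧-isIdeal (inΨXH-isIdeal ψ) const-isIdeal) p-nonneg

  outside-N-isIdeal : ∀ v → IsIdeal (λ X → not (inNX S X v))
  outside-N-isIdeal v = avoiding-isIdeal (λ w → inN S w v)

-- The `_` passed to the coverage lemmas
-- is fplt's local predicate "v ∉ supp φ", which cannot be named and is found by unification.
theorem2 : ∀ {n : ℕ} (S : Setting n) (dec : ∀ ψ v → Dec (_∼[_]_ S v ψ (Setting.r S)))
           → (∀ (X Y : Subset n) → (∀ v → v ∈ Y → InR S v) → X ⊆ Y
                → fplt S dec X ≤ fplt S dec Y)
           × (∀ (X Y : Subset n) → (∀ v → v ∈ X → InR S v) → (∀ v → v ∈ Y → InR S v)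
                → fplt S dec (X ∪ Y) + fplt S dec (X ∩ Y) ≤ fplt S dec X + fplt S dec Y)
theorem2 {n} S dec =
    (λ X Y _ → coverage-monotone (allFin n) _ outside-N P-nas)
  , (λ X Y _ _ → coverage-submodular (allFin n) _ outside-N P-nas X Y)
  where
  outside-N : ∀ v → IsIdeal (λ X → not (inNX S X v))
  outside-N = outside-N-isIdeal S
  P-nas : ∀ v → NonnegAntitoneSupermodular (λ X → connection-probability S dec X v)
  P-nas = connection-probability-nas S dec
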